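{- Let $\mathbf{r}$ be a ${\le}3$-irreducible word over $\Sigma_q$ containing at least three distinct symbols. Then there exist pairwise distinct symbols $a,b,c$, an integer $\ell\in\{0,1\}$ and a word $\mathbf{w}$ over $\{a,b,c\}$ of length at most three such that $\mathrm{Reg}(\mathbf{r})=\mathbf{w}(abc)^\ell ab$, and moreover: (1) whenever $\mathrm{Reg}(\mathbf{r})\xRightarrow[3_d]{*}\mathbf{z}$, the word $\mathbf{z}$ can be written as $\mathbf{w}(abc)^{m}ab$ for some integer $m\ge\ell$; and (2) the symbol of $\mathbf{r}$ immediately following the prefix $\mathrm{Reg}(\mathbf{r})$ is not $c$.
   Context: $\Sigma_q=\{0,\dots,q-1\}$. A tandem duplication of length $k$ replaces a word $\mathbf{u}\mathbf{v}\mathbf{w}$ with $|\mathbf{v}|=k$ by $\mathbf{u}\mathbf{v}\mathbf{v}\mathbf{w}$. A word $\mathbf{z}$ is ${\le}3$-irreducible if it cannot be obtained from any other word by a nonempty sequence of tandem duplications of lengths at most $3$. $\mathbf{x}\xRightarrow[3_d]{*}\mathbf{y}$ means $\mathbf{y}$ is obtained from $\mathbf{x}$ by a finite (possibly empty) sequence of tandem duplications of length $3$, each duplicating a segment of three pairwise distinct symbols. For $\mathbf{r}=r_1r_2\cdots r_{|\mathbf{r}|}$ ${\le}3$-irreducible with at least three distinct symbols, define (where any condition referring to $r_j$ with $j>|\mathbf{r}|$ is treated as: "$r_j=\cdot$" false and "$r_j\ne\cdot$" true): if $r_1=r_3$, $\mathrm{main}(\mathbf{r})=r_2r_3r_4$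 and $\mathrm{Reg}(\mathbf{r})=r_1r_2r_3r_4$ if $r_2\ne r_5$, $=r_1\cdots r_5$ if $r_2=r_5$ and $r_3\ne r_6$, and $=r_1\cdots r_6$ otherwise; if $r_1\ne r_3$, $\mathrm{main}(\mathbf{r})=r_1r_2r_3$ and $\mathrm{Reg}(\mathbf{r})=r_1r_2r_3$ if $r_1\ne r_4$, $=r_1\cdots r_4$ if $r_1=r_4$ and $r_2\ne r_5$, and $=r_1\cdots r_5$ otherwise. -}

module Defs where

open import Data.Nat using (ℕ; zero; suc; _≤_)
open import Data.Fin using (Fin)
open import Data.Fin.Properties using (_≟_)
open import Data.List using (List; []; _∷_; _++_; length; take; concat; replicate)
open import Data.List.Membership.Propositional using (_∈_)
open import Data.Maybe using (Maybe; just; nothing)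
open import Data.Bool using (Bool; true; false; if_then_else_; not)
open import Data.Product using (Σ; ∃; _×_; _,_)
open import Relation.Nullary using (¬_; does)
open import Relation.Binary.PropositionalEquality using (_≡_; _≢_)
open import Relation.Binary.Construct.Closure.Transitive using (TransClosure)
open import Relation.Binary.Construct.Closure.ReflexiveTransitive using (Star)

Word : ℕ → Set
Word q = List (Fin q)

TDup : ∀ {q} → ℕ → Word q → Word q → Set
TDup {q} k x y = Σ (Word q) λ u → Σ (Word q) λ v → Σ (Word q) λ w →
  length v ≡ k × x ≡ u ++ v ++ w × y ≡ u ++ v ++ v ++ w

TDup≤3 : ∀ {q} → Word q → Word q → Set
TDup≤3 x y = Σ ℕ λ k → 1 ≤ k × k ≤ 3 × TDup k x y

Irreducible≤3 : ∀ {q} → Word q → Set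
Irreducible≤3 {q} z = (x : Word q) → ¬ TransClosure TDup≤3 x z

TDup3d : ∀ {q} → Word q → Word q → Set
TDup3d {q} x y = Σ (Fin q) λ s₁ → Σ (Fin q) λ s₂ → Σ (Fin q) λ s₃ →
  s₁ ≢ s₂ × s₂ ≢ s₃ × s₁ ≢ s₃ ×
  Σ (Word q) λ u → Σ (Word q) λ w →
  x ≡ u ++ (s₁ ∷ s₂ ∷ s₃ ∷ []) ++ w × y ≡ u ++ (s₁ ∷ s₂ ∷ s₃ ∷ []) ++ (s₁ ∷ s₂ ∷ s₃ ∷ []) ++ w

_⇒3d*_ : ∀ {q} → Word q → Word q → Set
_⇒3d*_ = Star TDup3d

AtLeast3Distinct : ∀ {q} → Word q → Set
AtLeast3Distinct {q} r = Σ (Fin q) λ a → Σ (Fin q) λ b → Σ (Fin q) λ c →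
  a ≢ b × b ≢ c × a ≢ c × a ∈ r × b ∈ r × c ∈ r

-- 1-based lookup: r_j
at : ∀ {q} → Word q → ℕ → Maybe (Fin q)
at []      _             = nothing
at (x ∷ _) 1             = just x
at (_ ∷ xs) (suc (suc j)) = at xs (suc j)
at (_ ∷ _) zero          = nothing

-- "r_i = r_j": false whenever one of the positions is beyond |r|
eqAt : ∀ {q} → Word q → ℕ → ℕ → Bool
eqAt r i j with at r i | at r j
... | just x | just y = does (x ≟ y)
... | _      | _      = false

regLen : ∀ {q} → Word q → ℕ
regLen r =
  if eqAt r 1 3
  then (if not (eqAt r 2 5) then 4 else if not (eqAt r 3 6) then 5 else 6)
  else (if not (eqAt r 1 4) then 3 else if not (eqAt r 2 5) then 4 else 5)

Reg : ∀ {q} → Word q → Word q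
Reg r = take (regLen r) r

pow : ∀ {A : Set} → List A → ℕ → List A
pow v m = concat (replicate m v)

module Submission where

-- The argument rests on one combinatorial fact: duplicating a length-3
-- factor of a 3-periodic word keeps it 3-periodic and adds one period
-- (per-dup); the same holds after an extra leading y in front of
-- (xyz)^ω provided the duplicated factor has distinct end symbols
-- (cons-per-dup).  Hence every word w(abc)^m ab occurring below lies in a
-- family indexed by m that is closed under 3_d-duplication (DupClosed),
-- and everything reachable from a member stays in the family (reach).
--
-- Each of the six possible shapes of Reg(r) is an
-- instance of w(abc)^ℓ ab (lemmas reg-xyz … reg-xyxzyx); the required
-- inequalities between symbols come from the branch conditions or from
-- the absence of squares of length ≤ 3 in irreducible words, and words
-- with fewer than three distinct symbols are excluded by pigeonhole.

open import Defs
open import Data.Nat using (ℕ; zero; suc; _≤_; _+_; _*_; z≤n; s≤s)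
open import Data.Nat.Properties using (≤-refl; <⇒≤)
open import Data.Fin using (Fin)
open import Data.Fin.Properties using (_≟_)
open import Data.List using (List; []; _∷_; _++_; length)
open import Data.List.Properties using (∷-injective)
open import Data.List.Relation.Unary.All using (All; []; _∷_; lookup)
open import Data.Maybe using (Maybe; just)
open import Data.Sum using (_⊎_; inj₁; inj₂)
open import Data.Product using (Σ; _×_; _,_)
open import Data.Empty using (⊥; ⊥-elim)
open import Relation.Nullary using (¬_; yes; no)
open import Relation.Binary.PropositionalEquality
  using (_≡_; _≢_; refl; sym; trans; cong; cong₂; subst; ≢-sym)
open import Relation.Binary.Construct.Closure.Transitive using ([_])
open import Relation.Binary.Construct.Closure.ReflexiveTransitive using (ε; _◅_)

per : ∀ {A : Set} → A → A → A → ℕ → List A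
per x y z zero    = []
per x y z (suc n) = x ∷ per y z x n

pow-per : ∀ {A : Set} (x y z : A) m k →
  pow (x ∷ y ∷ z ∷ []) m ++ per x y z k ≡ per x y z (m * 3 + k)
pow-per x y z zero    k = refl
pow-per x y z (suc m) k = cong (λ t → x ∷ y ∷ z ∷ t) (pow-per x y z m k)

-- Duplicating any length-3 factor of a prefix of (xyz)^ω gives the prefix
-- that is three symbols longer: the factor is a rotation of xyz.
per-dup : ∀ {A : Set} (x y z : A) n u (t₁ t₂ t₃ : A) v →
  per x y z n ≡ u ++ (t₁ ∷ t₂ ∷ t₃ ∷ []) ++ v →
  u ++ (t₁ ∷ t₂ ∷ t₃ ∷ []) ++ (t₁ ∷ t₂ ∷ t₃ ∷ []) ++ v ≡ per x y z (3 + n)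
per-dup x y z zero                []      _  _  _  _ ()
per-dup x y z (suc zero)          []      _  _  _  _ ()
per-dup x y z (suc (suc zero))    []      _  _  _  _ ()
per-dup x y z (suc (suc (suc n))) []      _  _  _  _ refl = refl
per-dup x y z zero                (_ ∷ _) _  _  _  _ ()
per-dup x y z (suc n)             (s ∷ u) t₁ t₂ t₃ v eq with ∷-injective eq
... | x≡s , tail = cong₂ _∷_ (sym x≡s) (per-dup y z x n u t₁ t₂ t₃ v tail)

-- The same for y(xyz)^ω, as long as the duplicated factor t₁t₂t₃ has
-- t₁ ≢ t₃; this excludes the only non-periodic factor yxy at the front.
cons-per-dup : ∀ {A : Set} (x y z : A) n u (t₁ t₂ t₃ : A) v → t₁ ≢ t₃ →
  y ∷ per x y z n ≡ u ++ (t₁ ∷ t₂ ∷ t₃ ∷ []) ++ v →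
  u ++ (t₁ ∷ t₂ ∷ t₃ ∷ []) ++ (t₁ ∷ t₂ ∷ t₃ ∷ []) ++ v ≡ y ∷ per x y z (3 + n)
cons-per-dup x y z zero             []      _ _ _ _ _     ()
cons-per-dup x y z (suc zero)       []      _ _ _ _ _     ()
cons-per-dup x y z (suc (suc n))    []      _ _ _ _ t₁≢t₃ refl = ⊥-elim (t₁≢t₃ refl)
cons-per-dup x y z n                (s ∷ u) t₁ t₂ t₃ v _ eq with ∷-injective eq
... | y≡s , tail = cong₂ _∷_ (sym y≡s) (per-dup x y z n u t₁ t₂ t₃ v tail)

DupClosed : ∀ {q} → (ℕ → Word q) → Set
DupClosed {q} F = ∀ m {y : Word q} → TDup3d (F m) y → y ≡ F (suc m)

DupClosed-resp : ∀ {q} {F G : ℕ → Word q} → (∀ m → F m ≡ G m) → DupClosed G → DupClosed F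
DupClosed-resp F≡G closed m step =
  trans (closed m (subst (λ x → TDup3d x _) (F≡G m) step)) (sym (F≡G (suc m)))

per-closed : ∀ {q} (x y z : Fin q) (n : ℕ → ℕ) → (∀ m → n (suc m) ≡ 3 + n m) →
  DupClosed (λ m → per x y z (n m))
per-closed x y z n grows m (t₁ , t₂ , t₃ , _ , _ , _ , u , v , split , refl) =
  trans (per-dup x y z (n m) u t₁ t₂ t₃ v split) (cong (per x y z) (sym (grows m)))

cons-per-closed : ∀ {q} (x y z : Fin q) (n : ℕ → ℕ) → (∀ m → n (suc m) ≡ 3 + n m) →
  DupClosed (λ m → y ∷ per x y z (n m))
cons-per-closed x y z n grows m (t₁ , t₂ , t₃ , _ , _ , t₁≢t₃ , u , v , split , refl) =
  trans (cons-per-dup x y z (n m) u t₁ t₂ t₃ v t₁≢t₃ split)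
        (cong (λ k → y ∷ per x y z k) (sym (grows m)))

reach : ∀ {q} {F : ℕ → Word q} → DupClosed F → ∀ {x z} m → x ≡ F m → x ⇒3d* z →
  Σ ℕ λ m' → m ≤ m' × z ≡ F m'
reach closed m x≡Fm ε = m , ≤-refl , x≡Fm
reach closed m refl (step ◅ steps) with reach closed (suc m) (closed m step) steps
... | m' , m<m' , z≡Fm' = m' , <⇒≤ m<m' , z≡Fm'

canon : ∀ {q} → Word q → Fin q → Fin q → Fin q → ℕ → Word q
canon w a b c m = w ++ pow (a ∷ b ∷ c ∷ []) m ++ (a ∷ b ∷ [])

NotAt : ∀ {q} → Maybe (Fin q) → Fin q → Set
NotAt {q} next c = (s : Fin q) → next ≡ just s → s ≢ c

NotAt-just : ∀ {q} {c x : Fin q} → c ≢ x → NotAt (just x) c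
NotAt-just c≢x _ refl x≡c = c≢x (sym x≡c)

-- The conclusion of the theorem for a prefix R of r followed by the symbol
-- `next` (the theorem takes R = Reg r).
RegStructure : ∀ {q} → Word q → Maybe (Fin q) → Set
RegStructure {q} R next =
  Σ (Fin q) λ a → Σ (Fin q) λ b → Σ (Fin q) λ c →
  a ≢ b × b ≢ c × a ≢ c ×
  Σ ℕ λ ℓ → ℓ ≤ 1 ×
  Σ (Word q) λ w → All (λ x → x ≡ a ⊎ x ≡ b ⊎ x ≡ c) w × length w ≤ 3 ×
  R ≡ canon w a b c ℓ ×
  ((z : Word q) → R ⇒3d* z → Σ ℕ λ m → ℓ ≤ m × z ≡ canon w a b c m) ×
  NotAt next c

reg-structure-of : ∀ {q} {R : Word q} {next} (a b c : Fin q) → a ≢ b → b ≢ c → a ≢ c →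
  (ℓ : ℕ) → ℓ ≤ 1 → (w : Word q) → All (λ x → x ≡ a ⊎ x ≡ b ⊎ x ≡ c) w → length w ≤ 3 →
  R ≡ canon w a b c ℓ → DupClosed (λ m → w ++ per a b c (m * 3 + 2)) → NotAt next c →
  RegStructure R next
reg-structure-of a b c a≢b b≢c a≢c ℓ ℓ≤1 w w-abc |w|≤3 R≡ closed next≢c =
  a , b , c , a≢b , b≢c , a≢c , ℓ , ℓ≤1 , w , w-abc , |w|≤3 , R≡ ,
  (λ z R⇒z → reach canon-closed ℓ R≡ R⇒z) , next≢c
  where
  canon-closed : DupClosed (canon w a b c)
  canon-closed = DupClosed-resp (λ m → cong (w ++_) (pow-per a b c m 2)) closed

no-square : ∀ {q} (u v w : Word q) → 1 ≤ length v → length v ≤ 3 →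
  ¬ Irreducible≤3 (u ++ v ++ v ++ w)
no-square u v w 1≤|v| |v|≤3 irr =
  irr (u ++ v ++ w) [ length v , 1≤|v| , |v|≤3 , u , v , w , refl , refl , refl ]

adjacent-distinct : ∀ {q} (u : Word q) x y w → Irreducible≤3 (u ++ x ∷ y ∷ w) → x ≢ y
adjacent-distinct u x .x w irr refl = no-square u (x ∷ []) w (s≤s z≤n) (s≤s z≤n) irr

after-abcab : ∀ {q} (u : Word q) a b c rest →
  Irreducible≤3 (u ++ a ∷ b ∷ c ∷ a ∷ b ∷ rest) → NotAt (at rest 1) c
after-abcab u a b c []        irr _ ()
after-abcab u a b c (d ∷ rest) irr _ refl refl =
  no-square u (a ∷ b ∷ c ∷ []) rest (s≤s z≤n) (s≤s (s≤s (s≤s z≤n))) irr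

xyz-distinct : ∀ {q} {x y z : Fin q} {rest} → Irreducible≤3 (x ∷ y ∷ z ∷ rest) →
  x ≢ y × y ≢ z
xyz-distinct irr = adjacent-distinct [] _ _ _ irr , adjacent-distinct (_ ∷ []) _ _ _ irr

xyxz-distinct : ∀ {q} {x y z : Fin q} {rest} → Irreducible≤3 (x ∷ y ∷ x ∷ z ∷ rest) →
  x ≢ y × y ≢ z × x ≢ z
xyxz-distinct {x = x} {y} {rest = rest} irr =
  adjacent-distinct [] _ _ _ irr ,
  (λ { refl → no-square [] (x ∷ y ∷ []) rest (s≤s z≤n) (s≤s (s≤s z≤n)) irr }) ,
  adjacent-distinct (_ ∷ _ ∷ []) _ _ _ irr

two-symbols : ∀ {q} (x y : Fin q) {r} → All (λ s → s ≡ x ⊎ s ≡ y) r → ¬ AtLeast3Distinct r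
two-symbols x y over (a , b , c , a≢b , b≢c , a≢c , a∈r , b∈r , c∈r) =
  pigeonhole (lookup over a∈r) (lookup over b∈r) (lookup over c∈r)
  where
  pigeonhole : a ≡ x ⊎ a ≡ y → b ≡ x ⊎ b ≡ y → c ≡ x ⊎ c ≡ y → ⊥
  pigeonhole (inj₁ a≡) (inj₁ b≡) _         = a≢b (trans a≡ (sym b≡))
  pigeonhole (inj₂ a≡) (inj₂ b≡) _         = a≢b (trans a≡ (sym b≡))
  pigeonhole (inj₁ a≡) _         (inj₁ c≡) = a≢c (trans a≡ (sym c≡))
  pigeonhole (inj₂ a≡) _         (inj₂ c≡) = a≢c (trans a≡ (sym c≡))
  pigeonhole (inj₁ _)  (inj₂ b≡) (inj₂ c≡) = b≢c (trans b≡ (sym c≡))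
  pigeonhole (inj₂ _)  (inj₁ b≡) (inj₁ c≡) = b≢c (trans b≡ (sym c≡))

-- The six shapes of Reg(r).  Each is w(abc)^ℓ ab for the indicated
-- a, b, c, w, ℓ, and w(abc)^m ab is a prefix of (xyz)^ω or of y(xyz)^ω.

reg-xyz : ∀ {q} {x y z : Fin q} {rest} → Irreducible≤3 (x ∷ y ∷ z ∷ rest) → x ≢ z →
  NotAt (at rest 1) x → RegStructure (x ∷ y ∷ z ∷ []) (at rest 1)
reg-xyz {x = x} {y} {z} irr x≢z next≢x with xyz-distinct irr
... | x≢y , y≢z =
  reg-structure-of y z x y≢z (≢-sym x≢z) (≢-sym x≢y) 0 z≤n (x ∷ []) (inj₂ (inj₂ refl) ∷ [])
    (s≤s z≤n) refl (per-closed x y z (λ m → suc (m * 3 + 2)) (λ _ → refl)) next≢x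

reg-xyzx : ∀ {q} {x y z : Fin q} {rest} → Irreducible≤3 (x ∷ y ∷ z ∷ x ∷ rest) → x ≢ z →
  NotAt (at rest 1) y → RegStructure (x ∷ y ∷ z ∷ x ∷ []) (at rest 1)
reg-xyzx {x = x} {y} {z} irr x≢z next≢y with xyz-distinct irr
... | x≢y , y≢z =
  reg-structure-of z x y (≢-sym x≢z) x≢y (≢-sym y≢z) 0 z≤n (x ∷ y ∷ [])
    (inj₂ (inj₁ refl) ∷ inj₂ (inj₂ refl) ∷ []) (s≤s (s≤s z≤n)) refl
    (per-closed x y z (λ m → suc (suc (m * 3 + 2))) (λ _ → refl)) next≢y

reg-xyzxy : ∀ {q} {x y z : Fin q} {rest} → Irreducible≤3 (x ∷ y ∷ z ∷ x ∷ y ∷ rest) →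
  x ≢ z → RegStructure (x ∷ y ∷ z ∷ x ∷ y ∷ []) (at rest 1)
reg-xyzxy {x = x} {y} {z} irr x≢z with xyz-distinct irr
... | x≢y , y≢z =
  reg-structure-of x y z x≢y y≢z x≢z 1 ≤-refl [] [] z≤n refl
    (per-closed x y z (λ m → m * 3 + 2) (λ _ → refl)) (after-abcab [] x y z _ irr)

reg-xyxz : ∀ {q} {x y z : Fin q} {rest} → Irreducible≤3 (x ∷ y ∷ x ∷ z ∷ rest) →
  NotAt (at rest 1) y → RegStructure (x ∷ y ∷ x ∷ z ∷ []) (at rest 1)
reg-xyxz {x = x} {y} {z} irr next≢y with xyxz-distinct irr
... | x≢y , y≢z , x≢z =
  reg-structure-of x z y x≢z (≢-sym y≢z) x≢y 0 z≤n (x ∷ y ∷ [])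
    (inj₁ refl ∷ inj₂ (inj₂ refl) ∷ []) (s≤s (s≤s z≤n)) refl
    (cons-per-closed y x z (λ m → suc (m * 3 + 2)) (λ _ → refl)) next≢y

reg-xyxzy : ∀ {q} {x y z : Fin q} {rest} → Irreducible≤3 (x ∷ y ∷ x ∷ z ∷ y ∷ rest) →
  NotAt (at rest 1) x → RegStructure (x ∷ y ∷ x ∷ z ∷ y ∷ []) (at rest 1)
reg-xyxzy {x = x} {y} {z} irr next≢x with xyxz-distinct irr
... | x≢y , y≢z , x≢z =
  reg-structure-of z y x (≢-sym y≢z) (≢-sym x≢y) (≢-sym x≢z) 0 z≤n (x ∷ y ∷ x ∷ [])
    (inj₂ (inj₂ refl) ∷ inj₂ (inj₁ refl) ∷ inj₂ (inj₂ refl) ∷ []) (s≤s (s≤s (s≤s z≤n))) refl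
    (cons-per-closed y x z (λ m → suc (suc (m * 3 + 2))) (λ _ → refl)) next≢x

reg-xyxzyx : ∀ {q} {x y z : Fin q} {rest} → Irreducible≤3 (x ∷ y ∷ x ∷ z ∷ y ∷ x ∷ rest) →
  RegStructure (x ∷ y ∷ x ∷ z ∷ y ∷ x ∷ []) (at rest 1)
reg-xyxzyx {x = x} {y} {z} irr with xyxz-distinct irr
... | x≢y , y≢z , x≢z =
  reg-structure-of y x z (≢-sym x≢y) x≢z y≢z 1 ≤-refl (x ∷ []) (inj₂ (inj₁ refl) ∷ [])
    (s≤s z≤n) refl (cons-per-closed y x z (λ m → m * 3 + 2) (λ _ → refl))
    (after-abcab (x ∷ []) y x z _ irr)

reg-structure : ∀ {q} (r : Word q) → Irreducible≤3 r → AtLeast3Distinct r →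
  RegStructure (Reg r) (at r (length (Reg r) + 1))
reg-structure [] _ (_ , _ , _ , _ , _ , _ , () , _)
reg-structure (x ∷ []) _ d = ⊥-elim (two-symbols x x (inj₁ refl ∷ []) d)
reg-structure (x ∷ y ∷ []) _ d = ⊥-elim (two-symbols x y (inj₁ refl ∷ inj₂ refl ∷ []) d)
reg-structure (x₁ ∷ x₂ ∷ x₃ ∷ rest) irr d with x₁ ≟ x₃
... | no x₁≢x₃ with rest
...   | [] = reg-xyz irr x₁≢x₃ (λ _ ())
...   | x₄ ∷ rest₄ with x₁ ≟ x₄
...     | no x₁≢x₄ = reg-xyz irr x₁≢x₃ (NotAt-just x₁≢x₄)
...     | yes refl with rest₄
...       | [] = reg-xyzx irr x₁≢x₃ (λ _ ())
...       | x₅ ∷ rest₅ with x₂ ≟ x₅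
...         | no x₂≢x₅ = reg-xyzx irr x₁≢x₃ (NotAt-just x₂≢x₅)
...         | yes refl = reg-xyzxy irr x₁≢x₃
reg-structure (x₁ ∷ x₂ ∷ x₃ ∷ rest) irr d | yes refl with rest
... | [] = ⊥-elim (two-symbols x₁ x₂ (inj₁ refl ∷ inj₂ refl ∷ inj₁ refl ∷ []) d)
... | x₄ ∷ rest₄ with rest₄
...   | [] = reg-xyxz irr (λ _ ())
...   | x₅ ∷ rest₅ with x₂ ≟ x₅
...     | no x₂≢x₅ = reg-xyxz irr (NotAt-just x₂≢x₅)
...     | yes refl with rest₅
...       | [] = reg-xyxzy irr (λ _ ())
...       | x₆ ∷ rest₆ with x₁ ≟ x₆
...         | no x₁≢x₆ = reg-xyxzy irr (NotAt-just x₁≢x₆)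
...         | yes refl = reg-xyxzyx irr

lemma9 : (q : ℕ) (r : Word q) → Irreducible≤3 r → AtLeast3Distinct r →
    Σ (Fin q) λ a → Σ (Fin q) λ b → Σ (Fin q) λ c →
    a ≢ b × b ≢ c × a ≢ c ×
    Σ ℕ λ ℓ → ℓ ≤ 1 ×
    Σ (Word q) λ w → All (λ x → x ≡ a ⊎ x ≡ b ⊎ x ≡ c) w × length w ≤ 3 ×
    Reg r ≡ w ++ pow (a ∷ b ∷ c ∷ []) ℓ ++ (a ∷ b ∷ []) ×
    ((z : Word q) → Reg r ⇒3d* z →
      Σ ℕ λ m → ℓ ≤ m × z ≡ w ++ pow (a ∷ b ∷ c ∷ []) m ++ (a ∷ b ∷ [])) ×
    ((s : Fin q) → at r (length (Reg r) + 1) ≡ just s → s ≢ c)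
lemma9 q = reg-structure
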